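{- Every graph morphism $f:X\to Y$ in $\mathrm{Gph}$ factors as $f=p\circ w$, where $w$ is a Whiskering and $p$ is a Surjecting.
   Context: $\mathrm{Gph}$ is the category whose objects are graphs $X=(X_0,X_1,s,t)$: a set $X_0$ of nodes, a set $X_1$ of arcs, and functions $s,t:X_1\to X_0$ (source and target); graphs may be infinite, with loops and multiple arcs allowed. A graph morphism $f:X\to Y$ is a pair of functions $f_0:X_0\to Y_0$, $f_1:X_1\to Y_1$ with $s\circ f_1=f_0\circ s$ and $t\circ f_1=f_0\circ t$. For a node $x$ of $X$, $X(x,*)$ denotes the set of arcs with source $x$ and $X(*,x)$ the set of arcs with target $x$; a morphism $f$ induces functions $X(x,*)\to Y(f(x),*)$. A morphism $f:X\to Y$ is a Surjecting if $X(x,*)\to Y(f(x),*)$ is surjective for every $x\in X_0$. A node $x$ is a root of $X$ if $X(*,x)=\emptyset$; $R(X)$ denotes the set of roots viewed as a discrete subgraph (no arcs). A rooted tree is a graph $T$ with exactly one root $r$ such that for every node $x$ of $T$ there is a unique directed path in $T$ from $r$ to $x$. A rooted forest is a coproduct (disjoint union) of rooted trees. Given a rooted forest $F$ and a graph morphism $\varphi:R(F)\to X$, $X_F$ denotes the pushout of the inclusion $R(F)\to F$ and $\varphi$ ("attaching $F$ to $X$"). A graph morphism $f:X\to Y$ is a Whiskering if there exist a rooted forest $F$ and a morphism $\varphi:R(F)\to X$ and an isomorphism $Y\cong X_F$ under which $f$ corresponds to the canonical morphism $X\to X_F$. -}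

module Defs where

open import Level using (Level; suc; _⊔_; Lift)
open import Data.Empty using (⊥)
open import Data.Product using (Σ; _×_; _,_; proj₁; proj₂)
open import Relation.Nullary using (¬_)
open import Relation.Binary.PropositionalEquality using (_≡_)

record Graph (ℓ : Level) : Set (suc ℓ) where
  field
    Node : Set ℓ
    Arc  : Set ℓ
    src  : Arc → Node
    tgt  : Arc → Node
open Graph public

record Hom {ℓ : Level} (X Y : Graph ℓ) : Set ℓ where
  field
    hom₀  : Node X → Node Y
    hom₁  : Arc X → Arc Y
    hom-src : ∀ a → src Y (hom₁ a) ≡ hom₀ (src X a)
    hom-tgt : ∀ a → tgt Y (hom₁ a) ≡ hom₀ (tgt X a)
open Hom public

module _ {ℓ : Level} where

  infixr 9 _∘ₕ_
  _∘ₕ_ : {X Y Z : Graph ℓ} → Hom Y Z → Hom X Y → Hom X Z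
  _∘ₕ_ {X} {Y} {Z} g f = record
    { hom₀ = λ x → hom₀ g (hom₀ f x)
    ; hom₁ = λ a → hom₁ g (hom₁ f a)
    ; hom-src = λ a → trans' (hom-src g (hom₁ f a)) (cong' (hom₀ g) (hom-src f a))
    ; hom-tgt = λ a → trans' (hom-tgt g (hom₁ f a)) (cong' (hom₀ g) (hom-tgt f a))
    }
    where
    open import Relation.Binary.PropositionalEquality using () renaming (trans to trans'; cong to cong')

  infix 4 _≈ₕ_
  _≈ₕ_ : {X Y : Graph ℓ} → Hom X Y → Hom X Y → Set ℓ
  f ≈ₕ g = (∀ x → hom₀ f x ≡ hom₀ g x) × (∀ a → hom₁ f a ≡ hom₁ g a)

  IsSurjecting : {X Y : Graph ℓ} → Hom X Y → Set ℓ
  IsSurjecting {X} {Y} f =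
    ∀ (x : Node X) (b : Arc Y) → src Y b ≡ hom₀ f x →
      Σ (Arc X) λ a → (src X a ≡ x) × (hom₁ f a ≡ b)

  IsRoot : (X : Graph ℓ) → Node X → Set ℓ
  IsRoot X x = ¬ (Σ (Arc X) λ a → tgt X a ≡ x)

  data Path (X : Graph ℓ) : Node X → Node X → Set ℓ where
    [] : ∀ {x} → Path X x x
    _∷_ : ∀ {y} (a : Arc X) → Path X (tgt X a) y → Path X (src X a) y

  IsRootedTree : Graph ℓ → Set ℓ
  IsRootedTree T =
    Σ (Node T) λ r →
      IsRoot T r ×
      (∀ r' → IsRoot T r' → r' ≡ r) ×
      (∀ x → Σ (Path T r x) λ p → ∀ (q : Path T r x) → q ≡ p)

  Coproduct : (I : Set ℓ) → (I → Graph ℓ) → Graph ℓ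
  Coproduct I T = record
    { Node = Σ I λ i → Node (T i)
    ; Arc  = Σ I λ i → Arc (T i)
    ; src  = λ { (i , a) → i , src (T i) a }
    ; tgt  = λ { (i , a) → i , tgt (T i) a }
    }

  record RootedForest : Set (suc ℓ) where
    field
      Index : Set ℓ
      tree  : Index → Graph ℓ
      isTree : ∀ i → IsRootedTree (tree i)
    graph : Graph ℓ
    graph = Coproduct Index tree
  open RootedForest public

  Roots : Graph ℓ → Graph ℓ
  Roots X = record
    { Node = Σ (Node X) (IsRoot X)
    ; Arc  = Lift ℓ ⊥
    ; src  = λ ()
    ; tgt  = λ ()
    }

  rootIncl : (X : Graph ℓ) → Hom (Roots X) X
  rootIncl X = record
    { hom₀ = proj₁ ; hom₁ = λ () ; hom-src = λ () ; hom-tgt = λ () }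

  IsPushout : {A B C P : Graph ℓ} (u : Hom C A) (v : Hom C B)
              (i₁ : Hom A P) (i₂ : Hom B P) → Set (suc ℓ)
  IsPushout {A} {B} {C} {P} u v i₁ i₂ =
    (i₁ ∘ₕ u ≈ₕ i₂ ∘ₕ v) ×
    (∀ (Q : Graph ℓ) (k₁ : Hom A Q) (k₂ : Hom B Q) → k₁ ∘ₕ u ≈ₕ k₂ ∘ₕ v →
       Σ (Hom P Q) λ h → (h ∘ₕ i₁ ≈ₕ k₁) × (h ∘ₕ i₂ ≈ₕ k₂) ×
         (∀ (h' : Hom P Q) → h' ∘ₕ i₁ ≈ₕ k₁ → h' ∘ₕ i₂ ≈ₕ k₂ → h' ≈ₕ h))

  -- Whiskering: f : X → Y is (up to iso) the canonical map X → X_F, i.e.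
  -- Y together with f and some g : F → Y is a pushout of R(F) → F and φ : R(F) → X.
  IsWhiskering : {X Y : Graph ℓ} → Hom X Y → Set (suc ℓ)
  IsWhiskering {X} {Y} f =
    Σ RootedForest λ F →
    Σ (Hom (Roots (graph F)) X) λ φ →
    Σ (Hom (graph F) Y) λ g →
      IsPushout φ (rootIncl (graph F)) f g

module Submission where

-- For a node y of Y, the unfolding of Y at y is the graph whose
-- nodes are the directed walks in Y starting at y and whose arcs extend a walk
-- by one arc; it is a rooted tree, rooted at the empty walk.  Given f : X → Y,
-- attach to every node x of X the unfolding of Y at f x, gluing its root to x.
-- The resulting graph Z receives the Whiskering w : X → Z, and the map
-- p : Z → Y sending a walk to its end point is Surjecting: at any node of Z,
-- an arc of Y leaving its image extends the corresponding walk by one step.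

open import Defs
open import Level using (Level; lift)
open import Data.Product using (Σ; _×_; _,_; proj₁)
open import Data.Sum using (_⊎_; inj₁; inj₂)
open import Data.Empty using (⊥-elim)
open import Relation.Binary.PropositionalEquality
  using (_≡_; refl; sym; trans; cong; module ≡-Reasoning)

module _ {ℓ : Level} {G : Graph ℓ} where

  infixr 5 _++ₚ_
  _++ₚ_ : ∀ {x y z} → Path G x y → Path G y z → Path G x z
  []      ++ₚ q = q
  (a ∷ p) ++ₚ q = a ∷ (p ++ₚ q)

  ++ₚ-identityʳ : ∀ {x y} (p : Path G x y) → p ++ₚ [] ≡ p
  ++ₚ-identityʳ []      = refl
  ++ₚ-identityʳ (a ∷ p) = cong (a ∷_) (++ₚ-identityʳ p)

  snoc-++ₚ : ∀ {x z} (a : Arc G) (p : Path G x (src G a)) (q : Path G (tgt G a) z) →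
             (p ++ₚ (a ∷ [])) ++ₚ q ≡ p ++ₚ (a ∷ q)
  snoc-++ₚ a []       q = refl
  snoc-++ₚ a (a′ ∷ p) q = cong (a′ ∷_) (snoc-++ₚ a p q)

module Unfolding {ℓ : Level} (Y : Graph ℓ) (y₀ : Node Y) where

  mutual
    data Walk : Set ℓ where
      start  : Walk
      extend : (n : Walk) (b : Arc Y) → src Y b ≡ end n → Walk

    end : Walk → Node Y
    end start          = y₀
    end (extend n b e) = tgt Y b

  data Step : Set ℓ where
    step : (n : Walk) (b : Arc Y) → src Y b ≡ end n → Step

  walkTree : Graph ℓ
  walkTree = record
    { Node = Walk
    ; Arc  = Step
    ; src  = λ { (step n b e) → n }
    ; tgt  = λ { (step n b e) → extend n b e }
    }

  start-isRoot : IsRoot walkTree start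
  start-isRoot (step _ _ _ , ())

  root-unique : ∀ n → IsRoot walkTree n → n ≡ start
  root-unique start          _      = refl
  root-unique (extend n b e) isRoot = ⊥-elim (isRoot (step n b e , refl))

  canonical : ∀ n → Path walkTree start n
  canonical start          = []
  canonical (extend n b e) = canonical n ++ₚ (step n b e ∷ [])

  -- Every path from n to m extends the canonical path of n to that of m:
  -- a step out of n always leads to the walk n extended by that step.
  canonical-continues : ∀ {n m} (p : Path walkTree n m) →
                        canonical n ++ₚ p ≡ canonical m
  canonical-continues [] = ++ₚ-identityʳ (canonical _)
  canonical-continues (step n b e ∷ p) = begin
    canonical n ++ₚ (step n b e ∷ p)              ≡⟨ sym (snoc-++ₚ (step n b e) (canonical n) p) ⟩
    (canonical n ++ₚ (step n b e ∷ [])) ++ₚ p     ≡⟨ canonical-continues p ⟩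
    canonical _                                   ∎
    where open ≡-Reasoning

  -- The canonical path of the empty walk is empty, so every path from the
  -- root is the canonical one.
  walkTree-isTree : IsRootedTree walkTree
  walkTree-isTree =
    start , start-isRoot , root-unique ,
    λ n → canonical n , canonical-continues

coproduct-root : ∀ {ℓ} {I : Set ℓ} (T : I → Graph ℓ) {i : I} {n : Node (T i)} →
                 IsRoot (Coproduct I T) (i , n) → IsRoot (T i) n
coproduct-root T {i} isRoot (a , a↦n) = isRoot ((i , a) , cong (i ,_) a↦n)

-- Nodes of Z are the nodes of X together with the non-root
-- nodes of the trees, the latter represented by the step that reaches them.
module Attach {ℓ : Level} {X Y : Graph ℓ} (f₀ : Node X → Node Y) where

  open Unfolding Y using (Walk; start; extend; Step; step)

  treeAt : Node X → Graph ℓ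
  treeAt x = Unfolding.walkTree Y (f₀ x)

  forest : RootedForest
  forest = record { Index = Node X ; tree = treeAt
                  ; isTree = λ x → Unfolding.walkTree-isTree Y (f₀ x) }

  F : Graph ℓ
  F = graph forest

  TreeStep : Set ℓ
  TreeStep = Σ (Node X) λ x → Step (f₀ x)

  glue : (x : Node X) → Walk (f₀ x) → Node X ⊎ TreeStep
  glue x start          = inj₁ x
  glue x (extend n b e) = inj₂ (x , step n b e)

  Z : Graph ℓ
  Z = record
    { Node = Node X ⊎ TreeStep
    ; Arc  = Arc X ⊎ TreeStep
    ; src  = λ { (inj₁ a) → inj₁ (src X a) ; (inj₂ (x , step n b e)) → glue x n }
    ; tgt  = λ { (inj₁ a) → inj₁ (tgt X a) ; (inj₂ s) → inj₂ s }
    }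

  w : Hom X Z
  w = record { hom₀ = inj₁ ; hom₁ = inj₁ ; hom-src = λ _ → refl ; hom-tgt = λ _ → refl }

  g : Hom F Z
  g = record { hom₀ = λ { (x , n) → glue x n } ; hom₁ = inj₂
             ; hom-src = λ { (x , step n b e) → refl } ; hom-tgt = λ { (x , step n b e) → refl } }

  φ : Hom (Roots F) X
  φ = record { hom₀ = λ r → proj₁ (proj₁ r)
             ; hom₁ = λ { (lift ()) } ; hom-src = λ { (lift ()) } ; hom-tgt = λ { (lift ()) } }

  isRoot-start : ∀ x → IsRoot F (x , start)
  isRoot-start x ((_ , step _ _ _) , ())

  -- The square commutes: the only roots of F are the empty walks, glued to x.
  commutes : w ∘ₕ φ ≈ₕ g ∘ₕ rootIncl F
  commutes = glue-root , λ { (lift ()) }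
    where
    glue-root : (r : Node (Roots F)) → inj₁ (proj₁ (proj₁ r)) ≡ hom₀ g (proj₁ r)
    glue-root ((x , n) , isRoot)
      rewrite Unfolding.root-unique Y (f₀ x) n (coproduct-root treeAt isRoot) = refl

  -- The factorisation is forced: X goes via
  -- k₁, and a tree node reached by a step goes where k₂ sends it.
  module Factor (Q : Graph ℓ) (k₁ : Hom X Q) (k₂ : Hom F Q)
                (agree : k₁ ∘ₕ φ ≈ₕ k₂ ∘ₕ rootIncl F) where

    h₀ : Node Z → Node Q
    h₀ (inj₁ x)                = hom₀ k₁ x
    h₀ (inj₂ (x , step n b e)) = hom₀ k₂ (x , extend n b e)

    h₀-glue : ∀ x (n : Walk (f₀ x)) → h₀ (glue x n) ≡ hom₀ k₂ (x , n)
    h₀-glue x start          = proj₁ agree ((x , start) , isRoot-start x)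
    h₀-glue x (extend n b e) = refl

    h : Hom Z Q
    h = record
      { hom₀ = h₀
      ; hom₁ = λ { (inj₁ a) → hom₁ k₁ a ; (inj₂ s) → hom₁ k₂ s }
      ; hom-src = λ { (inj₁ a) → hom-src k₁ a
                    ; (inj₂ (x , step n b e)) → trans (hom-src k₂ (x , step n b e)) (sym (h₀-glue x n)) }
      ; hom-tgt = λ { (inj₁ a) → hom-tgt k₁ a ; (inj₂ (x , step n b e)) → hom-tgt k₂ (x , step n b e) }
      }

    h-unique : ∀ (h′ : Hom Z Q) → h′ ∘ₕ w ≈ₕ k₁ → h′ ∘ₕ g ≈ₕ k₂ → h′ ≈ₕ h
    h-unique h′ (onX₀ , onX₁) (onF₀ , onF₁) =
      (λ { (inj₁ x) → onX₀ x ; (inj₂ (x , step n b e)) → onF₀ (x , extend n b e) }) ,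
      (λ { (inj₁ a) → onX₁ a ; (inj₂ s) → onF₁ s })

    factorisation : Σ (Hom Z Q) λ k → (k ∘ₕ w ≈ₕ k₁) × (k ∘ₕ g ≈ₕ k₂) ×
                      (∀ (h′ : Hom Z Q) → h′ ∘ₕ w ≈ₕ k₁ → h′ ∘ₕ g ≈ₕ k₂ → h′ ≈ₕ k)
    factorisation = h , ((λ _ → refl) , (λ _ → refl))
                      , ((λ { (x , n) → h₀-glue x n }) , (λ _ → refl)) , h-unique

  w-isWhiskering : IsWhiskering w
  w-isWhiskering = forest , φ , g , commutes , Factor.factorisation

-- It is Surjecting because every arc of
-- Y leaving the end of a walk extends that walk.
module EndPoint {ℓ : Level} {X Y : Graph ℓ} (f : Hom X Y) where

  open Attach {X = X} {Y = Y} (hom₀ f)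
  open Unfolding Y using (Walk; start; extend; step; end)

  p₀ : Node Z → Node Y
  p₀ (inj₁ x)                = hom₀ f x
  p₀ (inj₂ (x , step n b e)) = tgt Y b

  p₀-glue : ∀ x (n : Walk (hom₀ f x)) → p₀ (glue x n) ≡ end (hom₀ f x) n
  p₀-glue x start          = refl
  p₀-glue x (extend n b e) = refl

  p : Hom Z Y
  p = record
    { hom₀ = p₀
    ; hom₁ = λ { (inj₁ a) → hom₁ f a ; (inj₂ (x , step n b e)) → b }
    ; hom-src = λ { (inj₁ a) → hom-src f a
                  ; (inj₂ (x , step n b e)) → trans e (sym (p₀-glue x n)) }
    ; hom-tgt = λ { (inj₁ a) → hom-tgt f a ; (inj₂ (x , step n b e)) → refl }
    }

  p-isSurjecting : IsSurjecting p
  p-isSurjecting (inj₁ x) b e =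
    inj₂ (x , step start b e) , refl , refl
  p-isSurjecting (inj₂ (x , step n b′ e′)) b e =
    inj₂ (x , step (extend n b′ e′) b e) , refl , refl

  p∘w≈f : p ∘ₕ w ≈ₕ f
  p∘w≈f = (λ _ → refl) , (λ _ → refl)

proposition1 : ∀ {ℓ : Level} {X Y : Graph ℓ} (f : Hom X Y) →
    Σ (Graph ℓ) λ Z → Σ (Hom X Z) λ w → Σ (Hom Z Y) λ p →
      IsWhiskering w × IsSurjecting p × (p ∘ₕ w ≈ₕ f)
proposition1 f = Z , w , p , w-isWhiskering , p-isSurjecting , p∘w≈f
  where
  open Attach (hom₀ f)
  open EndPoint f
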